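{- Let $\mathcal{U}\subseteq\mathbb{S}$ be a universe of Scoring games containing all numbers $s=\langle\emptyset^s\mid\emptyset^s\rangle$, $s\in\mathbb{R}$. If $\mathcal{U}$ is natural, then every game in $\mathcal{U}$ is stable.
   Context: Scoring games are built recursively: an atom $\emptyset^s$ ($s\in\mathbb{R}$) stands for an empty set of options carrying score $s$. Day-0 games are $\langle\emptyset^\ell\mid\emptyset^r\rangle$ with $\ell,r\in\mathbb{R}$; a game born by day $i+1$ is $\langle\mathcal{G}\mid\mathcal{H}\rangle$ where each of $\mathcal{G},\mathcal{H}$ is either a nonempty finite set of games born by day $i$ or a single atom. $\mathbb{S}$ is the set of all such games. $G^{\mathcal L},G^{\mathcal R}$ denote the Left/Right option sets (or atoms); a follower of $G$ is any game reachable from $G$ by a (possibly empty, not necessarily alternating) sequence of moves. The number $s$ denotes $\langle\emptyset^s\mid\emptyset^s\rangle$. Disjunctive sum: if $G=\langle\emptyset^{\ell_1}\mid\emptyset^{r_1}\rangle$, $H=\langle\emptyset^{\ell_2}\mid\emptyset^{r_2}\rangle$ then $G+H=\langle\emptyset^{\ell_1+\ell_2}\mid\emptyset^{r_1+r_2}\rangle$; otherwise $G+H$ has Left options $G^{L}+H$, $G+H^{L}$ (over all existing Left options), and if neither $G$ nor $H$ has a Left option the Left side is the atom $\emptyset^{\ell_1+\ell_2}$ where $\emptyset^{\ell_1},\emptyset^{\ell_2}$ are the Left atoms of $G,H$; symmetrically for Right. The conjugate $\sim\! G$ swaps roles recursively: $\sim\!\langle\emptyset^\ell\mid\emptyset^r\rangle=\langle\emptyset^{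 -r}\mid\emptyset^{ -\ell}\rangle$ and in general Left options of $\sim\! G$ are $\sim\! G^{R}$, Right options are $\sim\! G^{L}$, with atoms $\emptyset^s$ becoming $\emptyset^{ -s}$ on the opposite side. A universe is a set of Scoring games closed under disjunctive sum, under taking options, and under conjugation. Left-score and Right-score: $Ls(G)=\ell$ if $G^{\mathcal L}=\emptyset^\ell$, else $Ls(G)=\max_{G^L} Rs(G^L)$; $Rs(G)=r$ if $G^{\mathcal R}=\emptyset^r$, else $Rs(G)=\min_{G^R}Ls(G^R)$. For $G,H$ in a universe $\mathcal{U}$, $G\geqslant H$ means $Ls(G+X)\geqslant Ls(H+X)$ and $Rs(G+X)\geqslant Rs(H+X)$ for all $X\in\mathcal{U}$. Let $\mathbb{Np}$ be the set of short Normal-play games (game forms $\{G^{\mathcal L}\mid G^{\mathcal R}\}$ with finite option sets, last player to move wins), with its usual order $G\geqslant H$ iff Left wins $G-H$ moving second. The Normal-play mapping $\zeta:\mathbb{Np}\to\mathcal{U}$ sends $G$ to the Scoring game $\zeta(G)$ obtained by replacing every empty set of options in every follower of $G$ by the atom $\emptyset^0$. $\mathcal U$ is natural if $\zeta$ is an order-embedding: for all $G,H\in\mathbb{Np}$, $G\leqslant H$ iff $\zeta(G)\leqslant\zeta(H)$ in $\mathcal U$. A game is atomic if at least one of $G^{\mathcal L},G^{\mathcal R}$ is an atom. An atomic game $G$ is stable if $Ls(G)\leqslant Rs(G)$; a game is stable if every atomic follower of it (including itself) is stable. -}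

module Defs where

open import Level using (0ℓ)
open import Data.Product using (Σ; ∃; _×_; _,_)
open import Data.Sum using (_⊎_)
open import Data.Unit using (⊤)
open import Data.Empty using (⊥)
open import Data.List using (List; []; _∷_; _++_)
open import Data.List.Membership.Propositional using (_∈_)
open import Relation.Nullary using (¬_; Dec; yes; no)
open import Relation.Binary.PropositionalEquality using (_≡_; _≢_)
open import Relation.Binary.Structures using (IsTotalOrder)
open import Algebra.Structures using (IsCommutativeRing)

-- The real numbers, axiomatised as a (classical) complete ordered field.
-- Any model is isomorphic to ℝ; the theorem is quantified over all models.

record RealField : Set₁ where
  infixl 6 _+_
  infixl 7 _*_
  infix  4 _≤_ _≤?_
  field
    ℝ    : Set
    _+_  : ℝ → ℝ → ℝ
    _*_  : ℝ → ℝ → ℝ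
    -_   : ℝ → ℝ
    0#   : ℝ
    1#   : ℝ
    _≤_  : ℝ → ℝ → Set
    isCommutativeRing : IsCommutativeRing _≡_ _+_ _*_ -_ 0# 1#
    0≢1  : 0# ≢ 1#
    inverse : ∀ x → x ≢ 0# → ∃ λ y → x * y ≡ 1#
    isTotalOrder : IsTotalOrder _≡_ _≤_
    _≤?_ : ∀ x y → Dec (x ≤ y)          -- classical decidability of the order
    +-mono-≤ : ∀ {x y} z → x ≤ y → x + z ≤ y + z
    *-nonneg : ∀ {x y} → 0# ≤ x → 0# ≤ y → 0# ≤ x * y
    complete : (P : ℝ → Set) → ∃ P → (∃ λ b → ∀ x → P x → x ≤ b) →
               ∃ λ s → (∀ x → P x → x ≤ s) × (∀ b → (∀ x → P x → x ≤ b) → s ≤ b)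

data NP : Set where
  np : List NP → List NP → NP

mutual
  _+NP_ : NP → NP → NP
  g@(np gL gR) +NP h@(np hL hR) =
    np (addL gL h ++ addR g hL) (addL gR h ++ addR g hR)

  addL : List NP → NP → List NP
  addL []       h = []
  addL (g ∷ gs) h = (g +NP h) ∷ addL gs h

  addR : NP → List NP → List NP
  addR g []       = []
  addR g (h ∷ hs) = (g +NP h) ∷ addR g hs

mutual
  negNP : NP → NP
  negNP (np L R) = np (negList R) (negList L)

  negList : List NP → List NP
  negList []       = []
  negList (g ∷ gs) = negNP g ∷ negList gs

mutual
  LeftWins2nd : NP → Set
  LeftWins2nd (np L R) = AllLeftWins1st R

  AllLeftWins1st : List NP → Set
  AllLeftWins1st []       = ⊤
  AllLeftWins1st (g ∷ gs) = LeftWins1st g × AllLeftWins1st gs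

  LeftWins1st : NP → Set
  LeftWins1st (np L R) = AnyLeftWins2nd L

  AnyLeftWins2nd : List NP → Set
  AnyLeftWins2nd []       = ⊥
  AnyLeftWins2nd (g ∷ gs) = LeftWins2nd g ⊎ AnyLeftWins2nd gs

_≥NP_ : NP → NP → Set
G ≥NP H = LeftWins2nd (G +NP negNP H)

_≤NP_ : NP → NP → Set
G ≤NP H = H ≥NP G

module _ (RF : RealField) where
  open RealField RF

  mutual
    data Game : Set where
      ⟨_∣_⟩ : Side → Side → Game

    -- a side of a game: an atom ∅^s, or a nonempty finite list of options
    data Side : Set where
      atom : ℝ → Side
      opts : Game → List Game → Side

  num : ℝ → Game
  num s = ⟨ atom s ∣ atom s ⟩

  mutual
    _⊕_ : Game → Game → Game
    g@(⟨ gl ∣ gr ⟩) ⊕ h@(⟨ hl ∣ hr ⟩) = ⟨ sumSide gl hl g h ∣ sumSide gr hr g h ⟩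

    sumSide : Side → Side → Game → Game → Side
    sumSide (atom a)     (atom b)     g h = atom (a + b)
    sumSide (atom a)     (opts h1 hs) g h = opts (g ⊕ h1) (addRG g hs)
    sumSide (opts g1 gs) (atom b)     g h = opts (g1 ⊕ h) (addLG gs h)
    sumSide (opts g1 gs) (opts h1 hs) g h =
      opts (g1 ⊕ h) (addLG gs h ++ ((g ⊕ h1) ∷ addRG g hs))

    addLG : List Game → Game → List Game
    addLG []       h = []
    addLG (g ∷ gs) h = (g ⊕ h) ∷ addLG gs h

    addRG : Game → List Game → List Game
    addRG g []       = []
    addRG g (h ∷ hs) = (g ⊕ h) ∷ addRG g hs

  mutual
    ∼_ : Game → Game
    ∼ ⟨ gl ∣ gr ⟩ = ⟨ conjSide gr ∣ conjSide gl ⟩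

    conjSide : Side → Side
    conjSide (atom s)    = atom (- s)
    conjSide (opts g gs) = opts (∼ g) (conjList gs)

    conjList : List Game → List Game
    conjList []       = []
    conjList (g ∷ gs) = ∼ g ∷ conjList gs

  max : ℝ → ℝ → ℝ
  max x y with x ≤? y
  ... | yes _ = y
  ... | no  _ = x

  min : ℝ → ℝ → ℝ
  min x y with x ≤? y
  ... | yes _ = x
  ... | no  _ = y

  mutual
    Ls : Game → ℝ
    Ls ⟨ atom l    ∣ _ ⟩ = l
    Ls ⟨ opts g gs ∣ _ ⟩ = maxRs g gs

    Rs : Game → ℝ
    Rs ⟨ _ ∣ atom r    ⟩ = r
    Rs ⟨ _ ∣ opts g gs ⟩ = minLs g gs

    maxRs : Game → List Game → ℝ
    maxRs g []        = Rs g
    maxRs g (g' ∷ gs) = max (Rs g) (maxRs g' gs)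

    minLs : Game → List Game → ℝ
    minLs g []        = Ls g
    minLs g (g' ∷ gs) = min (Ls g) (minLs g' gs)

  _∈Side_ : Game → Side → Set
  h ∈Side atom _    = ⊥
  h ∈Side opts g gs = h ≡ g ⊎ h ∈ gs

  IsOption : Game → Game → Set
  IsOption h ⟨ gl ∣ gr ⟩ = h ∈Side gl ⊎ h ∈Side gr

  data Follower : Game → Game → Set where
    here  : ∀ {g} → Follower g g
    there : ∀ {h g' g} → IsOption g' g → Follower h g' → Follower h g

  IsAtom : Side → Set
  IsAtom (atom _)   = ⊤
  IsAtom (opts _ _) = ⊥

  Atomic : Game → Set
  Atomic ⟨ gl ∣ gr ⟩ = IsAtom gl ⊎ IsAtom gr

  Stable : Game → Set
  Stable g = ∀ h → Follower h g → Atomic h → Ls h ≤ Rs h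

  record IsUniverse (U : Game → Set) : Set where
    field
      closed-⊕   : ∀ g h → U g → U h → U (g ⊕ h)
      closed-opt : ∀ g h → U g → IsOption h g → U h
      closed-∼   : ∀ g → U g → U (∼ g)

  _≤[_]_ : Game → (Game → Set) → Game → Set
  g ≤[ U ] h = ∀ x → U x → (Ls (g ⊕ x) ≤ Ls (h ⊕ x)) × (Rs (g ⊕ x) ≤ Rs (h ⊕ x))

  mutual
    ζ : NP → Game
    ζ (np L R) = ⟨ ζSide L ∣ ζSide R ⟩

    ζSide : List NP → Side
    ζSide []       = atom 0#
    ζSide (g ∷ gs) = opts (ζ g) (ζList gs)

    ζList : List NP → List Game
    ζList []       = []
    ζList (g ∷ gs) = ζ g ∷ ζList gs

  Natural : (Game → Set) → Set
  Natural U = (∀ G → U (ζ G)) ×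
              (∀ G H → (G ≤NP H → ζ G ≤[ U ] ζ H) × (ζ G ≤[ U ] ζ H → G ≤NP H))

module Submission where

-- In Normal-play 0 ≤ 1 and -1 ≤ 0, so in a natural universe U we get
-- ζ 0 ≤ ζ 1 and ζ(-1) ≤ ζ 0 as Scoring games.  Test the first inequality
-- against a game X ∈ U whose Left side is an atom: the Left-score of
-- ζ 0 + X is Ls X (ζ 0 is the Scoring zero ⟨∅⁰ ∣ ∅⁰⟩), while in ζ 1 + X
-- Left's only move is to ζ 0 + X, so its Left-score is Rs X.  Hence
-- Ls X ≤ Rs X.  Dually, the Right-scores in ζ(-1) ≤ ζ 0 give Ls X ≤ Rs X
-- when X has an atomic Right side.  Thus every atomic game of U is stable,
-- and since a universe is closed under options, every follower of a game
-- of U lies in U, which yields the theorem.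

open import Defs
open import Data.Product using (_,_; proj₁; proj₂)
open import Data.Sum using (inj₁; inj₂)
open import Data.Unit using (tt)
open import Data.List using ([]; _∷_)
open import Relation.Binary.PropositionalEquality using (_≡_; cong₂; sym)
open import Relation.Binary.Bundles using (Preorder)
open import Relation.Binary.Structures using (IsTotalOrder)
open import Algebra.Structures using (IsCommutativeRing)

zeroNP oneNP minusOneNP : NP
zeroNP     = np [] []
oneNP      = np (zeroNP ∷ []) []
minusOneNP = np [] (zeroNP ∷ [])

-- 0 ≤ 1: in 1 - 0 Right has no move, so Left wins moving second.
zero≤one : zeroNP ≤NP oneNP
zero≤one = tt

-- -1 ≤ 0: likewise in 0 - (-1) = 1 Right has no move.
minusOne≤zero : minusOneNP ≤NP zeroNP
minusOne≤zero = tt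

module _ (RF : RealField) where
  open RealField RF
  open IsCommutativeRing isCommutativeRing using (+-identityˡ)

  ℝ-preorder : Preorder _ _ _
  ℝ-preorder = record { isPreorder = IsTotalOrder.isPreorder isTotalOrder }

  open import Relation.Binary.Reasoning.Preorder ℝ-preorder

  𝟘 : Game RF
  𝟘 = ζ RF zeroNP

  -- Adding 𝟘 changes neither score: 𝟘 ⊕ x has the options of x (with 𝟘
  -- added) and atoms shifted by 0.  The list lemmas handle option lists.
  mutual
    Ls-𝟘⊕ : ∀ x → Ls RF (_⊕_ RF 𝟘 x) ≡ Ls RF x
    Ls-𝟘⊕ ⟨ atom l    ∣ _ ⟩ = +-identityˡ l
    Ls-𝟘⊕ ⟨ opts g gs ∣ _ ⟩ = maxRs-𝟘⊕ g gs

    Rs-𝟘⊕ : ∀ x → Rs RF (_⊕_ RF 𝟘 x) ≡ Rs RF x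
    Rs-𝟘⊕ ⟨ _ ∣ atom r    ⟩ = +-identityˡ r
    Rs-𝟘⊕ ⟨ _ ∣ opts g gs ⟩ = minLs-𝟘⊕ g gs

    maxRs-𝟘⊕ : ∀ g gs → maxRs RF (_⊕_ RF 𝟘 g) (addRG RF 𝟘 gs) ≡ maxRs RF g gs
    maxRs-𝟘⊕ g []        = Rs-𝟘⊕ g
    maxRs-𝟘⊕ g (g' ∷ gs) = cong₂ (max RF) (Rs-𝟘⊕ g) (maxRs-𝟘⊕ g' gs)

    minLs-𝟘⊕ : ∀ g gs → minLs RF (_⊕_ RF 𝟘 g) (addRG RF 𝟘 gs) ≡ minLs RF g gs
    minLs-𝟘⊕ g []        = Ls-𝟘⊕ g
    minLs-𝟘⊕ g (g' ∷ gs) = cong₂ (min RF) (Ls-𝟘⊕ g) (minLs-𝟘⊕ g' gs)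

  -- If Left has no move in x, her only move in ζ 1 ⊕ x is to 𝟘 ⊕ x,
  -- after which Right starts: the Left-score is Rs x.
  Ls-ζ1⊕ : ∀ l xr → Ls RF (_⊕_ RF (ζ RF oneNP) ⟨ atom l ∣ xr ⟩) ≡ Rs RF ⟨ atom l ∣ xr ⟩
  Ls-ζ1⊕ l xr = Rs-𝟘⊕ ⟨ atom l ∣ xr ⟩

  Rs-ζ-1⊕ : ∀ xl r → Rs RF (_⊕_ RF (ζ RF minusOneNP) ⟨ xl ∣ atom r ⟩) ≡ Ls RF ⟨ xl ∣ atom r ⟩
  Rs-ζ-1⊕ xl r = Ls-𝟘⊕ ⟨ xl ∣ atom r ⟩

  -- Every atomic game of a natural universe is stable: compare Left-scores
  -- in ζ 0 ≤ ζ 1, or Right-scores in ζ(-1) ≤ ζ 0.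
  natural⇒atomic-stable : (U : Game RF → Set) → Natural RF U →
    ∀ x → U x → Atomic RF x → Ls RF x ≤ Rs RF x
  natural⇒atomic-stable U (_ , embedding) x@(⟨ atom l ∣ xr ⟩) Ux (inj₁ _) =
    begin
      Ls RF x                          ≡⟨ sym (Ls-𝟘⊕ x) ⟩
      Ls RF (_⊕_ RF 𝟘 x)               ≲⟨ proj₁ (ζ0≤ζ1 x Ux) ⟩
      Ls RF (_⊕_ RF (ζ RF oneNP) x)    ≡⟨ Ls-ζ1⊕ l xr ⟩
      Rs RF x                          ∎
    where ζ0≤ζ1 = proj₁ (embedding zeroNP oneNP) zero≤one
  natural⇒atomic-stable U (_ , embedding) x@(⟨ xl ∣ atom r ⟩) Ux (inj₂ _) =
    begin
      Ls RF x                              ≡⟨ sym (Rs-ζ-1⊕ xl r) ⟩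
      Rs RF (_⊕_ RF (ζ RF minusOneNP) x)   ≲⟨ proj₂ (ζ-1≤ζ0 x Ux) ⟩
      Rs RF (_⊕_ RF 𝟘 x)                   ≡⟨ Rs-𝟘⊕ x ⟩
      Rs RF x                              ∎
    where ζ-1≤ζ0 = proj₁ (embedding minusOneNP zeroNP) minusOne≤zero

  follower∈universe : (U : Game RF → Set) → IsUniverse RF U →
    ∀ {h g} → Follower RF h g → U g → U h
  follower∈universe U universe here                          Ug = Ug
  follower∈universe U universe (there {g' = g'} {g = g} o f) Ug =
    follower∈universe U universe f (IsUniverse.closed-opt universe g g' Ug o)

theorem1 : (RF : RealField) (U : Game RF → Set) →
    IsUniverse RF U →
    (∀ s → U (num RF s)) →
    Natural RF U →
    ∀ g → U g → Stable RF g
theorem1 RF U universe _ natural g Ug h h-follows-g h-atomic =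
  natural⇒atomic-stable RF U natural h
    (follower∈universe RF U universe h-follows-g Ug) h-atomic
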